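{- For any real numbers $\Lambda_\sigma$ indexed by noncrossing partitions $\sigma$ of $[n]$, the vector $v=\sum_\sigma\Lambda_\sigma f_\sigma$ satisfies \[\Delta_{[n],\{\tilde1\}}(v)=\Delta_{[n],\{\tilde2\}}(v)=\dots=\Delta_{[n],\{\tilde n\}}(v)=\Lambda_{\{1\},\{2\},\dots,\{n\}}\] and \[\Delta_{\{1\},[\tilde n]}(v)=\Delta_{\{2\},[\tilde n]}(v)=\dots=\Delta_{\{n\},[\tilde n]}(v)=\Lambda_{\{1,2,\dots,n\}}.\]
   Context: $V=\mathbb{R}^{2n}$ with basis $e_1,e_{\tilde1},\dots,e_n,e_{\tilde n}$, totally ordered $1<\tilde1<\dots<n<\tilde n$ and circularly ordered the same way. For $I\subseteq[n]$, $\tilde I\subseteq[\tilde n]$ with $|I|+|\tilde I|=n+1$, $e_{I,\tilde I}$ is the ordered wedge of the $e_i$, $i\in I\sqcup\tilde I$; these form a basis of $\Lambda^{n+1}V$ and $\Delta_{I,\tilde I}(v)$ denotes the coefficient of $e_{I,\tilde I}$ in $v$. For a noncrossing partition $\sigma$ of $[n]$, its Kreweras complement $\tilde\sigma$ is the unique noncrossing partition of $[\tilde n]$ with $\sigma\sqcup\tilde\sigma$ noncrossing on $[n]\sqcup[\tilde n]$. $(I,\tilde I)$ is concordant with $(\sigma,\tilde\sigma)$ if $I$ has exactly one element in each block of $\sigma$ and $\tilde I$ exactly one in each block of $\tilde\sigma$; $f_\sigma=\sum_{(I,\tilde I)\text{ concordant}}e_{I,\tilde I}$. $\{1\},\{2\},\dots,\{n\}$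 denotes the partition into singletons and $\{1,\dots,n\}$ the one-block partition. -}

module Defs where

open import Data.Bool using (Bool; true; false; _∧_; _∨_; not; if_then_else_)
open import Data.Nat using (ℕ; zero; suc; _+_; _*_; _<ᵇ_; _≤ᵇ_; _≡ᵇ_)
open import Data.Nat.Properties using (+-comm)
open import Data.Fin using (Fin; zero; suc; toℕ; _≟_)
open import Data.Fin.Subset using (Subset; ⊤; ⁅_⁆; ∣_∣)
open import Data.Fin.Subset.Properties using (∣⊤∣≡n; ∣⁅x⁆∣≡1)
open import Data.Vec using (Vec; []; _∷_; lookup; tabulate; replicate)
open import Data.List using (List; []; _∷_; _++_; map; concatMap; foldr; allFin; length)
open import Data.Bool.ListAction using (all; any)
open import Data.Sum using (_⊎_; inj₁; inj₂)
open import Data.Product using (Σ; _×_; _,_; proj₁; proj₂)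
open import Relation.Nullary.Decidable using (⌊_⌋)
open import Relation.Binary.PropositionalEquality using (_≡_; cong₂; trans)
open import Algebra.Bundles using (CommutativeRing)

filterᵇ : {A : Set} → (A → Bool) → List A → List A
filterᵇ p []       = []
filterᵇ p (x ∷ xs) = if p x then x ∷ filterᵇ p xs else filterᵇ p xs

eqF : {n : ℕ} → Fin n → Fin n → Bool
eqF i j = ⌊ i ≟ j ⌋

allVec : (k m : ℕ) → List (Vec (Fin m) k)
allVec zero    m = [] ∷ []
allVec (suc k) m = concatMap (λ x → map (x ∷_) (allVec k m)) (allFin m)

noncrossingOn : {A : Set} → List A → (A → ℕ) → (A → A → Bool) → Bool
noncrossingOn xs pos same =
  all (λ a → all (λ b → all (λ c → all (λ d →
    not ((pos a <ᵇ pos b) ∧ (pos b <ᵇ pos c) ∧ (pos c <ᵇ pos d)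
         ∧ same a c ∧ same b d ∧ not (same a b))) xs) xs) xs) xs

-- Set partitions of [n] = {0,…,n-1} (standing for 1 < … < n).
-- A partition is encoded by the vector ℓ sending each point to the
-- minimal element of its block ("canonical" labelling); this gives a
-- bijection between canonical labellings and set partitions.

Partition : ℕ → Set
Partition n = Vec (Fin n) n

sameBlock : {n : ℕ} → Partition n → Fin n → Fin n → Bool
sameBlock ℓ i j = eqF (lookup ℓ i) (lookup ℓ j)

canonical : {n : ℕ} → Partition n → Bool
canonical {n} ℓ =
  all (λ i → (toℕ (lookup ℓ i) ≤ᵇ toℕ i) ∧ eqF (lookup ℓ (lookup ℓ i)) (lookup ℓ i))
      (allFin n)

isNC : {n : ℕ} → Partition n → Bool
isNC {n} ℓ = canonical ℓ ∧ noncrossingOn (allFin n) toℕ (sameBlock ℓ)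

NCs : (n : ℕ) → List (Partition n)
NCs n = filterᵇ isNC (allVec n n)

singletons : (n : ℕ) → Partition n
singletons n = tabulate (λ i → i)

oneBlock : (n : ℕ) → Partition n
oneBlock zero    = []
oneBlock (suc m) = replicate (suc m) zero

-- The interleaved set [n] ⊔ [ñ] with 1 < 1̃ < 2 < 2̃ < … < n < ñ:
-- point i ↦ position 2i, point ĩ ↦ position 2i+1.

jointPos : {n : ℕ} → Fin n ⊎ Fin n → ℕ
jointPos (inj₁ i) = 2 * toℕ i
jointPos (inj₂ i) = suc (2 * toℕ i)

jointNC : {n : ℕ} → Partition n → Partition n → Bool
jointNC {n} σ τ = noncrossingOn (map inj₁ (allFin n) ++ map inj₂ (allFin n)) jointPos same
  where
  same : Fin n ⊎ Fin n → Fin n ⊎ Fin n → Bool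
  same (inj₁ i) (inj₁ j) = sameBlock σ i j
  same (inj₂ i) (inj₂ j) = sameBlock τ i j
  same _        _        = false

-- τ is the Kreweras complement σ̃ of σ: τ is a noncrossing partition of
-- [ñ] with σ ⊔ τ noncrossing (such τ is unique).
isKreweras : {n : ℕ} → Partition n → Partition n → Bool
isKreweras σ τ = isNC τ ∧ jointNC σ τ

transversal : {n : ℕ} → Partition n → Subset n → Bool
transversal {n} ℓ I =
  all (λ j → not (eqF (lookup ℓ j) j)
             ∨ (length (filterᵇ (λ i → lookup I i ∧ eqF (lookup ℓ i) j) (allFin n)) ≡ᵇ 1))
      (allFin n)

concordant : {n : ℕ} → Partition n → Subset n → Subset n → Bool
concordant {n} σ I J =
  transversal σ I ∧ any (λ τ → isKreweras σ τ ∧ transversal τ J) (NCs n)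

-- Λ^{n+1} V with its basis e_{I,Ĩ}, |I| + |Ĩ| = n+1; an element is given
-- by its coordinates in this basis.

BasisIdx : ℕ → Set
BasisIdx n = Σ (Subset n × Subset n) (λ p → ∣ proj₁ p ∣ + ∣ proj₂ p ∣ ≡ suc n)

module Wedge {c ℓ} (R : CommutativeRing c ℓ) (n : ℕ) where
  open CommutativeRing R renaming (_+_ to _+R_; _*_ to _*R_)

  ΛV : Set c
  ΛV = BasisIdx n → Carrier

  Δ : BasisIdx n → ΛV → Carrier
  Δ k v = v k

  f : Partition n → ΛV
  f σ ((I , J) , _) = if concordant σ I J then 1# else 0#

  vec : (Partition n → Carrier) → ΛV
  vec Λ k = foldr (λ σ acc → (Λ σ *R f σ k) +R acc) 0# (NCs n)

idxL : {n : ℕ} → Fin n → BasisIdx n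
idxL {n} i = (⊤ , ⁅ i ⁆) , trans (cong₂ _+_ (∣⊤∣≡n n) (∣⁅x⁆∣≡1 i)) (+-comm n 1)

idxR : {n : ℕ} → Fin n → BasisIdx n
idxR {n} i = (⁅ i ⁆ , ⊤) , cong₂ _+_ (∣⁅x⁆∣≡1 i) (∣⊤∣≡n n)

{-# OPTIONS --safe #-}
module Submission where

-- The coordinate of v at e_{I,Ĩ} is the sum of the Λ_σ over the noncrossing σ concordant with
-- (I,Ĩ). If I = [n] meets every block of σ exactly once, all blocks are singletons; if I = {i}
-- does, σ has a single block. Conversely the discrete and the one-block partition are Kreweras
-- complements of each other (a partition with only one non-singleton block cannot cross), and
-- {ĩ}, resp. [ñ], is a transversal of that complement. So each such coordinate is a single Λ_σ.

open import Defs
open import Data.Nat using (ℕ)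
open import Data.Fin using (Fin)
open import Data.Product using (_×_)
open import Algebra.Bundles using (CommutativeRing)

open import Data.Bool using (Bool; true; false; T; not; _∧_; if_then_else_)
open import Data.Bool.Properties using (T-∧; T-∨; T-≡)
open import Data.Bool.ListAction using (all; any)
open import Data.Empty using (⊥; ⊥-elim)
open import Data.Unit using (⊤; tt)
open import Data.Nat using (suc; _<_; _≤_; z≤n; _≤ᵇ_; _<ᵇ_; _≡ᵇ_)
open import Data.Nat.Properties using (<ᵇ⇒<; ≤ᵇ⇒≤; ≤⇒≤ᵇ; ≡ᵇ⇒≡; ≤-refl; <-irrefl; <-trans; n≤0⇒n≡0)
open import Data.Fin using (zero; toℕ; _≟_)
import Data.Fin.Properties as Fin
import Data.Nat as Nat
open import Data.Fin.Subset using (Subset; ⁅_⁆; ∣_∣) renaming (⊤ to Full)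
open import Data.Fin.Subset.Properties using (x∈⁅x⁆; x∈⁅y⁆⇒x≡y)
open import Data.Vec using (Vec; []; _∷_; lookup)
open import Data.Vec.Properties
  using (lookup-replicate; lookup∘tabulate; tabulate∘lookup; tabulate-cong; []=⇒lookup; lookup⇒[]=;
         ∷-injectiveʳ)
open import Data.List using (List; []; _∷_; _++_; map; foldr; filter; allFin; length)
open import Data.List.Membership.Propositional using (_∈_; lose)
open import Data.List.Membership.Propositional.Properties
  using (∈-allFin; ∈-map⁺; ∈-map⁻; ∈-filter⁺; ∈-filter⁻; ∈-concatMap⁺)
open import Data.List.Properties using (filter-none)
open import Data.List.Relation.Unary.All as All using (All; [])
open import Data.List.Relation.Unary.All.Properties using (all⁺; all⁻)
import Data.List.Relation.Unary.All.Properties as All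
open import Data.List.Relation.Unary.Any using (here; there)
open import Data.List.Relation.Unary.Any.Properties using (any⁺)
open import Data.List.Relation.Unary.AllPairs as AllPairs using ([]; _∷_)
import Data.List.Relation.Unary.AllPairs.Properties as AllPairs
open import Data.List.Relation.Unary.Unique.Propositional using (Unique)
import Data.List.Relation.Unary.Unique.Propositional.Properties as Unique
open import Data.List.Relation.Binary.Disjoint.Propositional using (Disjoint)
open import Data.Sum using (_⊎_; inj₁; inj₂)
open import Data.Product using (∃; _,_; proj₁; proj₂)
open import Function using (_∘_; Equivalence)
open import Relation.Nullary using (¬_; yes; no)
open import Relation.Nullary.Decidable using (T?; toWitness; fromWitness)
open import Relation.Unary using (Decidable)
open import Relation.Binary.PropositionalEquality
  using (_≡_; _≢_; refl; sym; trans; cong; cong₂; subst)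

∧⁻ : ∀ {x y} → T (x ∧ y) → T x × T y
∧⁻ = Equivalence.to T-∧

∧⁺ : ∀ {x y} → T x × T y → T (x ∧ y)
∧⁺ = Equivalence.from T-∧

T-not⁺ : ∀ {b} → ¬ T b → T (not b)
T-not⁺ {false} _  = tt
T-not⁺ {true}  ¬b = ¬b tt

T-not⁻ : ∀ {b} → T (not b) → ¬ T b
T-not⁻ {false} _ ()

eqF⇒≡ : ∀ {n} {i j : Fin n} → T (eqF i j) → i ≡ j
eqF⇒≡ = toWitness

≡⇒eqF : ∀ {n} {i j : Fin n} → i ≡ j → T (eqF i j)
≡⇒eqF = fromWitness

all-allFin⁺ : ∀ {n} (p : Fin n → Bool) → (∀ i → T (p i)) → T (all p (allFin n))
all-allFin⁺ {n} p h = all⁻ p {allFin n} (All.tabulate λ {i} _ → h i)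

all-allFin⁻ : ∀ {n} (p : Fin n → Bool) → T (all p (allFin n)) → ∀ i → T (p i)
all-allFin⁻ p h i = All.lookup (all⁺ p _ h) (∈-allFin i)

all-map : ∀ {A : Set} {p q : A → Bool} {xs} →
  T (all p xs) → (∀ x → T (p x) → T (q x)) → T (all q xs)
all-map {p = p} {q} {xs} h f = all⁻ q (All.map (f _) (all⁺ p xs h))

all⁴-map : ∀ {A : Set} {p q : A → A → A → A → Bool} {xs} →
  T (all (λ a → all (λ b → all (λ c → all (λ d → p a b c d) xs) xs) xs) xs) →
  (∀ a b c d → T (p a b c d) → T (q a b c d)) →
  T (all (λ a → all (λ b → all (λ c → all (λ d → q a b c d) xs) xs) xs) xs)
all⁴-map {xs = xs} h f =
  all-map {xs = xs} h λ a ha → all-map {xs = xs} ha λ b hb →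
  all-map {xs = xs} hb λ c hc → all-map {xs = xs} hc λ d → f a b c d

length≡1⇒singleton : ∀ {A : Set} (xs : List A) → length xs ≡ 1 → ∃ λ x → xs ≡ x ∷ []
length≡1⇒singleton (x ∷ []) refl = x , refl

filterᵇ≡filter : ∀ {A : Set} (p : A → Bool) xs → filterᵇ p xs ≡ filter (T? ∘ p) xs
filterᵇ≡filter p []       = refl
filterᵇ≡filter p (x ∷ xs) with p x
... | true  = cong (x ∷_) (filterᵇ≡filter p xs)
... | false = filterᵇ≡filter p xs

filter≡[_] : ∀ {A : Set} {P : A → Set} {P? : Decidable P} {xs} s → Unique xs → s ∈ xs → P s →
             (∀ {x} → x ∈ xs → P x → x ≡ s) → filter P? xs ≡ s ∷ []
filter≡[_] {P = P} {P?} {x ∷ xs} s (x∉xs ∷ xs!) s∈ ps only with P? x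
... | yes px = cong₂ _∷_ x≡s (filter-none P? (All.tabulate rejected))
  where
  x≡s : x ≡ s
  x≡s = only (here refl) px
  rejected : ∀ {y} → y ∈ xs → ¬ P y
  rejected y∈ py = All.lookup x∉xs y∈ (trans x≡s (sym (only (there y∈) py)))
... | no ¬px with s∈
...   | here refl = ⊥-elim (¬px ps)
...   | there s∈xs = filter≡[ s ] xs! s∈xs ps (only ∘ there)

filterᵇ≡[_] : ∀ {A : Set} {p : A → Bool} {xs} s → Unique xs → s ∈ xs → T (p s) →
               (∀ {x} → x ∈ xs → T (p x) → x ≡ s) → filterᵇ p xs ≡ s ∷ []
filterᵇ≡[_] {p = p} {xs} s xs! s∈ ps only =
  trans (filterᵇ≡filter p xs) (filter≡[_] {P? = T? ∘ p} s xs! s∈ ps only)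

∈-filterᵇ⁺ : ∀ {A : Set} (p : A → Bool) {xs x} → x ∈ xs → T (p x) → x ∈ filterᵇ p xs
∈-filterᵇ⁺ p {xs} x∈ px rewrite filterᵇ≡filter p xs = ∈-filter⁺ (T? ∘ p) x∈ px

∈-filterᵇ⁻ : ∀ {A : Set} (p : A → Bool) {xs x} → x ∈ filterᵇ p xs → T (p x)
∈-filterᵇ⁻ p {xs} x∈ rewrite filterᵇ≡filter p xs = proj₂ (∈-filter⁻ (T? ∘ p) {xs = xs} x∈)

∈-allVec : ∀ k m (v : Vec (Fin m) k) → v ∈ allVec k m
∈-allVec 0       m []      = here refl
∈-allVec (suc k) m (x ∷ v) =
  ∈-concatMap⁺ _ (lose (∈-allFin x) (∈-map⁺ (x ∷_) (∈-allVec k m v)))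

allVec-unique : ∀ k m → Unique (allVec k m)
allVec-unique 0       m = [] ∷ []
allVec-unique (suc k) m =
  Unique.concat⁺ (All.map⁺ (All.tabulate λ _ → Unique.map⁺ ∷-injectiveʳ (allVec-unique k m)))
                 (AllPairs.map⁺ (AllPairs.map disjoint (Unique.allFin⁺ m)))
  where
  disjoint : ∀ {x y} → x ≢ y → Disjoint (map (x ∷_) (allVec k m)) (map (y ∷_) (allVec k m))
  disjoint x≢y (v∈x , v∈y) with ∈-map⁻ (_ ∷_) v∈x | ∈-map⁻ (_ ∷_) v∈y
  ... | _ , _ , refl | _ , _ , refl = x≢y refl

NCs-unique : ∀ n → Unique (NCs n)
NCs-unique n rewrite filterᵇ≡filter isNC (allVec n n) =
  Unique.filter⁺ (T? ∘ isNC) (allVec-unique n n)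

∈-NCs⁺ : ∀ {n} {σ : Partition n} → T (isNC σ) → σ ∈ NCs n
∈-NCs⁺ {n} {σ} = ∈-filterᵇ⁺ isNC (∈-allVec n n σ)

∈-NCs⁻ : ∀ {n} {σ : Partition n} → σ ∈ NCs n → T (isNC σ)
∈-NCs⁻ {n} = ∈-filterᵇ⁻ isNC {allVec n n}

isNC⇒canonical : ∀ {n} (σ : Partition n) → T (isNC σ) → T (canonical σ)
isNC⇒canonical σ = proj₁ ∘ ∧⁻

≗⇒≡ : ∀ {A : Set} {n} {u v : Vec A n} → (∀ i → lookup u i ≡ lookup v i) → u ≡ v
≗⇒≡ {u = u} {v} eq = trans (sym (tabulate∘lookup u)) (trans (tabulate-cong eq) (tabulate∘lookup v))

lookup-singletons : ∀ {n} (i : Fin n) → lookup (singletons n) i ≡ i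
lookup-singletons = lookup∘tabulate (λ j → j)

lookup-oneBlock : ∀ {m} (i : Fin (suc m)) → lookup (oneBlock (suc m)) i ≡ zero
lookup-oneBlock i = lookup-replicate i zero

sameBlock-singletons : ∀ {n} {a b : Fin n} → T (sameBlock (singletons n) a b) → a ≡ b
sameBlock-singletons {a = a} {b} s rewrite lookup-singletons a | lookup-singletons b = eqF⇒≡ s

sameBlock-oneBlock : ∀ {m} (a b : Fin (suc m)) → T (sameBlock (oneBlock (suc m)) a b)
sameBlock-oneBlock a b rewrite lookup-oneBlock a | lookup-oneBlock b = tt

canonical⁺ : ∀ {n} (ℓ : Partition n) →
             (∀ i → toℕ (lookup ℓ i) ≤ toℕ i × lookup ℓ (lookup ℓ i) ≡ lookup ℓ i) → T (canonical ℓ)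
canonical⁺ ℓ h = all-allFin⁺ _ λ i → ∧⁺ (≤⇒≤ᵇ (proj₁ (h i)) , ≡⇒eqF (proj₂ (h i)))

canonical⁻ : ∀ {n} (ℓ : Partition n) → T (canonical ℓ) →
             ∀ i → toℕ (lookup ℓ i) ≤ toℕ i × lookup ℓ (lookup ℓ i) ≡ lookup ℓ i
canonical⁻ ℓ h i with ∧⁻ (all-allFin⁻ _ h i)
... | le , root = ≤ᵇ⇒≤ (toℕ (lookup ℓ i)) (toℕ i) le , eqF⇒≡ root

canonical-singletons : ∀ n → T (canonical (singletons n))
canonical-singletons n = canonical⁺ (singletons n) λ i →
  subst (λ j → toℕ j ≤ toℕ i × lookup (singletons n) j ≡ j) (sym (lookup-singletons i))
        (≤-refl , lookup-singletons i)

canonical-oneBlock : ∀ m → T (canonical (oneBlock (suc m)))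
canonical-oneBlock m = canonical⁺ (oneBlock (suc m)) λ i →
  subst (λ j → toℕ j ≤ toℕ i × lookup (oneBlock (suc m)) j ≡ j) (sym (lookup-oneBlock i))
        (z≤n , lookup-oneBlock zero)

-- A crossing needs two different blocks with two points each; only Big points share a block
-- with a later point, and all Big points form one block.
noncrossing-oneBigBlock : ∀ {A : Set} (xs : List A) (pos : A → ℕ) (same : A → A → Bool)
  (Big : A → Set) →
  (∀ a c → pos a < pos c → T (same a c) → Big a) → (∀ a b → Big a → Big b → T (same a b)) →
  T (noncrossingOn xs pos same)
noncrossing-oneBigBlock xs pos same Big big-only big-block =
  all⁻ _ (All.universal (λ a → all⁻ _ (All.universal (λ b → all⁻ _ (All.universal (λ c →
  all⁻ _ (All.universal (λ d → T-not⁺ (noCrossing a b c d)) xs)) xs)) xs)) xs)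
  where
  noCrossing : ∀ a b c d →
    ¬ T ((pos a <ᵇ pos b) ∧ (pos b <ᵇ pos c) ∧ (pos c <ᵇ pos d)
         ∧ same a c ∧ same b d ∧ not (same a b))
  noCrossing a b c d h with ∧⁻ {pos a <ᵇ pos b} h
  ... | a<b , h with ∧⁻ {pos b <ᵇ pos c} h
  ... | b<c , h with ∧⁻ {pos c <ᵇ pos d} h
  ... | c<d , h with ∧⁻ {same a c} h
  ... | ac , h with ∧⁻ {same b d} h
  ... | bd , a≁b = T-not⁻ a≁b (big-block a b (big-only a c a<c ac) (big-only b d b<d bd))
    where
    a<c : pos a < pos c
    a<c = <-trans (<ᵇ⇒< (pos a) (pos b) a<b) (<ᵇ⇒< (pos b) (pos c) b<c)
    b<d : pos b < pos d
    b<d = <-trans (<ᵇ⇒< (pos b) (pos c) b<c) (<ᵇ⇒< (pos c) (pos d) c<d)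

isNC-singletons : ∀ n → T (isNC (singletons n))
isNC-singletons n = ∧⁺ (canonical-singletons n ,
  noncrossing-oneBigBlock (allFin n) toℕ (sameBlock (singletons n)) (λ _ → ⊥)
    (λ a c a<c a∼c → <-irrefl (cong toℕ (sameBlock-singletons a∼c)) a<c) (λ _ _ ()))

isNC-oneBlock : ∀ m → T (isNC (oneBlock (suc m)))
isNC-oneBlock m = ∧⁺ (canonical-oneBlock m ,
  noncrossing-oneBigBlock (allFin (suc m)) toℕ (sameBlock (oneBlock (suc m))) (λ _ → ⊤)
    (λ _ _ _ _ → tt) (λ a b _ _ → sameBlock-oneBlock a b))

jointPoints : ∀ n → List (Fin n ⊎ Fin n)
jointPoints n = map inj₁ (allFin n) ++ map inj₂ (allFin n)

joinedSame : ∀ {n} → Partition n → Partition n → Fin n ⊎ Fin n → Fin n ⊎ Fin n → Bool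
joinedSame σ τ (inj₁ i) (inj₁ j) = sameBlock σ i j
joinedSame σ τ (inj₂ i) (inj₂ j) = sameBlock τ i j
joinedSame σ τ _        _        = false

-- The block relation of σ ⊔ τ is local to jointNC, so it is restated as joinedSame;
-- the two agree definitionally once all four points are split into [n] and [ñ].
jointNC⁺ : ∀ {n} (σ τ : Partition n) →
  T (noncrossingOn (jointPoints n) jointPos (joinedSame σ τ)) → T (jointNC σ τ)
jointNC⁺ {n} σ τ nc = all⁴-map {xs = jointPoints n} nc λ
  { (inj₁ _) (inj₁ _) (inj₁ _) (inj₁ _) h → h ; (inj₁ _) (inj₁ _) (inj₁ _) (inj₂ _) h → h
  ; (inj₁ _) (inj₁ _) (inj₂ _) (inj₁ _) h → h ; (inj₁ _) (inj₁ _) (inj₂ _) (inj₂ _) h → h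
  ; (inj₁ _) (inj₂ _) (inj₁ _) (inj₁ _) h → h ; (inj₁ _) (inj₂ _) (inj₁ _) (inj₂ _) h → h
  ; (inj₁ _) (inj₂ _) (inj₂ _) (inj₁ _) h → h ; (inj₁ _) (inj₂ _) (inj₂ _) (inj₂ _) h → h
  ; (inj₂ _) (inj₁ _) (inj₁ _) (inj₁ _) h → h ; (inj₂ _) (inj₁ _) (inj₁ _) (inj₂ _) h → h
  ; (inj₂ _) (inj₁ _) (inj₂ _) (inj₁ _) h → h ; (inj₂ _) (inj₁ _) (inj₂ _) (inj₂ _) h → h
  ; (inj₂ _) (inj₂ _) (inj₁ _) (inj₁ _) h → h ; (inj₂ _) (inj₂ _) (inj₁ _) (inj₂ _) h → h
  ; (inj₂ _) (inj₂ _) (inj₂ _) (inj₁ _) h → h ; (inj₂ _) (inj₂ _) (inj₂ _) (inj₂ _) h → h }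

jointNC-discrete-oneBlock : ∀ {n} (σ τ : Partition n) → (∀ {a b} → T (sameBlock σ a b) → a ≡ b) →
                            (∀ a b → T (sameBlock τ a b)) → T (jointNC σ τ)
jointNC-discrete-oneBlock {n} σ τ σ-discrete τ-oneBlock =
  jointNC⁺ σ τ (noncrossing-oneBigBlock (jointPoints n) jointPos (joinedSame σ τ) Big
    (λ { (inj₁ a) (inj₁ c) a<c a∼c → <-irrefl (cong (jointPos ∘ inj₁) (σ-discrete a∼c)) a<c
       ; (inj₂ a) _ _ _ → tt })
    (λ { (inj₂ a) (inj₂ b) _ _ → τ-oneBlock a b }))
  where
  Big : Fin n ⊎ Fin n → Set
  Big (inj₁ _) = ⊥
  Big (inj₂ _) = ⊤

jointNC-oneBlock-discrete : ∀ {n} (σ τ : Partition n) → (∀ a b → T (sameBlock σ a b)) →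
                            (∀ {a b} → T (sameBlock τ a b) → a ≡ b) → T (jointNC σ τ)
jointNC-oneBlock-discrete {n} σ τ σ-oneBlock τ-discrete =
  jointNC⁺ σ τ (noncrossing-oneBigBlock (jointPoints n) jointPos (joinedSame σ τ) Big
    (λ { (inj₂ a) (inj₂ c) a<c a∼c → <-irrefl (cong (jointPos ∘ inj₂) (τ-discrete a∼c)) a<c
       ; (inj₁ a) _ _ _ → tt })
    (λ { (inj₁ a) (inj₁ b) _ _ → σ-oneBlock a b }))
  where
  Big : Fin n ⊎ Fin n → Set
  Big (inj₁ _) = ⊤
  Big (inj₂ _) = ⊥

isKreweras-singletons : ∀ m → T (isKreweras (singletons (suc m)) (oneBlock (suc m)))
isKreweras-singletons m = ∧⁺ (isNC-oneBlock m ,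
  jointNC-discrete-oneBlock (singletons (suc m)) (oneBlock (suc m))
    sameBlock-singletons sameBlock-oneBlock)

isKreweras-oneBlock : ∀ m → T (isKreweras (oneBlock (suc m)) (singletons (suc m)))
isKreweras-oneBlock m = ∧⁺ (isNC-singletons (suc m) ,
  jointNC-oneBlock-discrete (oneBlock (suc m)) (singletons (suc m))
    sameBlock-oneBlock sameBlock-singletons)

inBlockᵇ : ∀ {n} → Partition n → Subset n → Fin n → Fin n → Bool
inBlockᵇ ℓ I j i = lookup I i ∧ eqF (lookup ℓ i) j

blockMembers : ∀ {n} → Partition n → Subset n → Fin n → List (Fin n)
blockMembers {n} ℓ I j = filterᵇ (inBlockᵇ ℓ I j) (allFin n)

∈-blockMembers⁺ : ∀ {n} (ℓ : Partition n) I {j i} →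
  T (lookup I i) → lookup ℓ i ≡ j → i ∈ blockMembers ℓ I j
∈-blockMembers⁺ ℓ I {j} {i} i∈I ℓi≡j =
  ∈-filterᵇ⁺ (inBlockᵇ ℓ I j) (∈-allFin i) (∧⁺ (i∈I , ≡⇒eqF ℓi≡j))

∈-blockMembers⁻ : ∀ {n} (ℓ : Partition n) I {j i} →
  i ∈ blockMembers ℓ I j → T (lookup I i) × lookup ℓ i ≡ j
∈-blockMembers⁻ {n} ℓ I {j} i∈ with ∧⁻ (∈-filterᵇ⁻ (inBlockᵇ ℓ I j) {allFin n} i∈)
... | i∈I , ℓi≡j = i∈I , eqF⇒≡ ℓi≡j

blockMembers≡single : ∀ {n} (ℓ : Partition n) I {j} k → T (lookup I k) → lookup ℓ k ≡ j →
  (∀ {i} → T (lookup I i) → lookup ℓ i ≡ j → i ≡ k) → blockMembers ℓ I j ≡ k ∷ []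
blockMembers≡single ℓ I {j} k k∈I ℓk≡j only =
  filterᵇ≡[_] {p = inBlockᵇ ℓ I j} k (Unique.allFin⁺ _) (∈-allFin k) (∧⁺ (k∈I , ≡⇒eqF ℓk≡j))
    (λ _ h → let i∈I , ℓi≡j = ∧⁻ h in only i∈I (eqF⇒≡ ℓi≡j))

transversal⁺ : ∀ {n} (ℓ : Partition n) (I : Subset n) →
  (∀ j → lookup ℓ j ≡ j → ∃ λ k → blockMembers ℓ I j ≡ k ∷ []) → T (transversal ℓ I)
transversal⁺ ℓ I one = all-allFin⁺ _ λ j → Equivalence.from T-∨ (meetsOnce j)
  where
  meetsOnce : ∀ j → T (not (eqF (lookup ℓ j) j)) ⊎ T (length (blockMembers ℓ I j) ≡ᵇ 1)
  meetsOnce j with eqF (lookup ℓ j) j in root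
  ... | false = inj₁ tt
  ... | true with one j (eqF⇒≡ (subst T (sym root) tt))
  ...   | k , ≡[k] rewrite ≡[k] = inj₂ tt

transversal⁻ : ∀ {n} (ℓ : Partition n) I → T (transversal ℓ I) →
  ∀ j → lookup ℓ j ≡ j → ∃ λ k → blockMembers ℓ I j ≡ k ∷ []
transversal⁻ ℓ I h j root with Equivalence.to T-∨ (all-allFin⁻ _ h j)
... | inj₁ notRoot = ⊥-elim (T-not⁻ notRoot (≡⇒eqF root))
... | inj₂ once    = length≡1⇒singleton (blockMembers ℓ I j) (≡ᵇ⇒≡ _ 1 once)

lookup-Full : ∀ {n} (i : Fin n) → T (lookup (Full {n}) i)
lookup-Full i rewrite lookup-replicate i true = tt

lookup-⁅⁆⇒≡ : ∀ {n} {i j : Fin n} → T (lookup ⁅ i ⁆ j) → j ≡ i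
lookup-⁅⁆⇒≡ {i = i} {j} h = x∈⁅y⁆⇒x≡y i (lookup⇒[]= j ⁅ i ⁆ (Equivalence.to T-≡ h))

lookup-⁅⁆-self : ∀ {n} (i : Fin n) → T (lookup ⁅ i ⁆ i)
lookup-⁅⁆-self i = Equivalence.from T-≡ ([]=⇒lookup (x∈⁅x⁆ i))

transversal-singletons-Full : ∀ n → T (transversal (singletons n) Full)
transversal-singletons-Full n = transversal⁺ (singletons n) Full λ j _ →
  j , blockMembers≡single (singletons n) Full j (lookup-Full j) (lookup-singletons j)
        (λ {i} _ ℓi≡j → trans (sym (lookup-singletons i)) ℓi≡j)

transversal-oneBlock-⁅⁆ : ∀ {m} (i : Fin (suc m)) → T (transversal (oneBlock (suc m)) ⁅ i ⁆)
transversal-oneBlock-⁅⁆ {m} i = transversal⁺ (oneBlock (suc m)) ⁅ i ⁆ λ j root →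
  i , blockMembers≡single (oneBlock (suc m)) ⁅ i ⁆ i (lookup-⁅⁆-self i)
        (trans (lookup-oneBlock i) (trans (sym (lookup-oneBlock j)) root))
        (λ i′∈⁅i⁆ _ → lookup-⁅⁆⇒≡ i′∈⁅i⁆)

transversal-Full⇒singletons : ∀ {n} (ℓ : Partition n) → T (canonical ℓ) → T (transversal ℓ Full) →
  ℓ ≡ singletons n
transversal-Full⇒singletons {n} ℓ can tr = ≗⇒≡ λ i → trans (fixed i) (sym (lookup-singletons i))
  where
  fixed : ∀ i → lookup ℓ i ≡ i
  fixed i with transversal⁻ ℓ Full tr (lookup ℓ i) (proj₂ (canonical⁻ ℓ can i))
  ... | k , ≡[k] = trans (member (proj₂ (canonical⁻ ℓ can i))) (sym (member refl))
    where
    member : ∀ {x} → lookup ℓ x ≡ lookup ℓ i → x ≡ k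
    member {x} ℓx≡ℓi with subst (x ∈_) ≡[k] (∈-blockMembers⁺ ℓ Full (lookup-Full x) ℓx≡ℓi)
    ... | here x≡k = x≡k

transversal-⁅⁆⇒oneBlock : ∀ {m} (ℓ : Partition (suc m)) (i : Fin (suc m)) → T (canonical ℓ) →
  T (transversal ℓ ⁅ i ⁆) → ℓ ≡ oneBlock (suc m)
transversal-⁅⁆⇒oneBlock {m} ℓ i can tr = ≗⇒≡ λ j →
  trans (sym (rootOf-i (lookup ℓ j) (proj₂ (canonical⁻ ℓ can j))))
        (trans (rootOf-i zero ℓ0≡0) (sym (lookup-oneBlock j)))
  where
  rootOf-i : ∀ r → lookup ℓ r ≡ r → lookup ℓ i ≡ r
  rootOf-i r root with transversal⁻ ℓ ⁅ i ⁆ tr r root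
  ... | k , ≡[k] with ∈-blockMembers⁻ ℓ ⁅ i ⁆ (subst (k ∈_) (sym ≡[k]) (here refl))
  ...   | k∈⁅i⁆ , ℓk≡r = subst (λ x → lookup ℓ x ≡ r) (lookup-⁅⁆⇒≡ k∈⁅i⁆) ℓk≡r
  ℓ0≡0 : lookup ℓ zero ≡ zero
  ℓ0≡0 = Fin.toℕ-injective (n≤0⇒n≡0 (proj₁ (canonical⁻ ℓ can zero)))

concordant⁺ : ∀ {n} (σ τ : Partition n) I J →
  T (transversal σ I) → T (isKreweras σ τ) → T (transversal τ J) → T (concordant σ I J)
concordant⁺ σ τ I J σI σ̃τ τJ =
  ∧⁺ (σI , any⁺ (λ τ′ → isKreweras σ τ′ ∧ transversal τ′ J)
              (lose (∈-NCs⁺ (proj₁ (∧⁻ σ̃τ))) (∧⁺ (σ̃τ , τJ))))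

concordant⇒transversal : ∀ {n} (σ : Partition n) I J → T (concordant σ I J) → T (transversal σ I)
concordant⇒transversal σ I J = proj₁ ∘ ∧⁻

concordant-singletons : ∀ {m} (i : Fin (suc m)) → T (concordant (singletons (suc m)) Full ⁅ i ⁆)
concordant-singletons {m} i = concordant⁺ (singletons (suc m)) (oneBlock (suc m)) Full ⁅ i ⁆
  (transversal-singletons-Full (suc m)) (isKreweras-singletons m) (transversal-oneBlock-⁅⁆ i)

concordant-oneBlock : ∀ {m} (i : Fin (suc m)) → T (concordant (oneBlock (suc m)) ⁅ i ⁆ Full)
concordant-oneBlock {m} i = concordant⁺ (oneBlock (suc m)) (singletons (suc m)) ⁅ i ⁆ Full
  (transversal-oneBlock-⁅⁆ i) (isKreweras-oneBlock m) (transversal-singletons-Full (suc m))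

concordant-Full⇒singletons : ∀ {n} (σ : Partition n) J → T (isNC σ) → T (concordant σ Full J) →
  σ ≡ singletons n
concordant-Full⇒singletons σ J σ-nc σ-conc =
  transversal-Full⇒singletons σ (isNC⇒canonical σ σ-nc) (concordant⇒transversal σ Full J σ-conc)

concordant-⁅⁆⇒oneBlock : ∀ {m} (σ : Partition (suc m)) i J → T (isNC σ) → T (concordant σ ⁅ i ⁆ J) →
  σ ≡ oneBlock (suc m)
concordant-⁅⁆⇒oneBlock σ i J σ-nc σ-conc =
  transversal-⁅⁆⇒oneBlock σ i (isNC⇒canonical σ σ-nc) (concordant⇒transversal σ ⁅ i ⁆ J σ-conc)

module _ {c ℓ} (R : CommutativeRing c ℓ) where
  open CommutativeRing R renaming (refl to ≈-refl; trans to ≈-trans)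
  open import Relation.Binary.Reasoning.Setoid setoid

  ∑ : ∀ {A : Set} → List A → (A → Carrier) → Carrier
  ∑ xs g = foldr (λ x acc → g x + acc) 0# xs

  ∑-indicator : ∀ {A : Set} (p : A → Bool) (g : A → Carrier) xs →
    ∑ xs (λ x → g x * (if p x then 1# else 0#)) ≈ ∑ (filterᵇ p xs) g
  ∑-indicator p g []       = ≈-refl
  ∑-indicator p g (x ∷ xs) with p x
  ... | true  = +-cong (*-identityʳ (g x)) (∑-indicator p g xs)
  ... | false = ≈-trans (+-cong (zeroʳ (g x)) (∑-indicator p g xs)) (+-identityˡ _)

  vec-uniqueConcordant : ∀ {n} (Λ : Partition n → Carrier) I J (e : ∣ I ∣ Nat.+ ∣ J ∣ ≡ suc n)
    (s : Partition n) →
    T (isNC s) → T (concordant s I J) → (∀ σ → T (isNC σ) → T (concordant σ I J) → σ ≡ s) →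
    Wedge.vec R n Λ ((I , J) , e) ≈ Λ s
  vec-uniqueConcordant {n} Λ I J e s s-nc s-conc only = begin
    Wedge.vec R n Λ ((I , J) , e)                   ≈⟨ ∑-indicator (λ σ → concordant σ I J) Λ (NCs n) ⟩
    ∑ (filterᵇ (λ σ → concordant σ I J) (NCs n)) Λ  ≡⟨ cong (λ xs → ∑ xs Λ) concordantNCs ⟩
    Λ s + 0#                                         ≈⟨ +-identityʳ (Λ s) ⟩
    Λ s                                              ∎
    where
    concordantNCs : filterᵇ (λ σ → concordant σ I J) (NCs n) ≡ s ∷ []
    concordantNCs = filterᵇ≡[ s ] (NCs-unique n) (∈-NCs⁺ s-nc) s-conc (λ σ∈ → only _ (∈-NCs⁻ σ∈))

lemma4p1 : ∀ {c ℓ} (R : CommutativeRing c ℓ) (n : ℕ)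
    (Λ : Partition n → CommutativeRing.Carrier R) →
    let open CommutativeRing R
        open Wedge R n
    in ((i : Fin n) → Δ (idxL i) (vec Λ) ≈ Λ (singletons n))
       × ((i : Fin n) → Δ (idxR i) (vec Λ) ≈ Λ (oneBlock n))
lemma4p1 R Nat.zero Λ = (λ ()) , (λ ())
lemma4p1 R (suc m) Λ =
  (λ i → vec-uniqueConcordant R Λ Full ⁅ i ⁆ (proj₂ (idxL i)) (singletons (suc m))
           (isNC-singletons (suc m)) (concordant-singletons i)
           (λ σ → concordant-Full⇒singletons σ ⁅ i ⁆)) ,
  (λ i → vec-uniqueConcordant R Λ ⁅ i ⁆ Full (proj₂ (idxR i)) (oneBlock (suc m))
           (isNC-oneBlock m) (concordant-oneBlock i) (λ σ → concordant-⁅⁆⇒oneBlock σ i Full))
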